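{- Let $\mathcal{L} = (G, a_0, I, \theta)$ be a ladget with $G=(V,E)$ and $I=(i_1,\dots,i_n)$. Then: (1) no two inputs are adjacent; (2) $a_0$ is not adjacent to any input; (3) no internal vertex (a vertex of $V \setminus (I \cup \{a_0,\theta\})$) is adjacent to three distinct vertices of $I \cup \{a_0\}$.
   Context: A ladget is a tuple $\mathcal{L}=(G,a_0,I,\theta)$ where $G=(V,E)$ is a finite simple graph, $a_0\in V$ is the anchor vertex, $I=(i_1,\dots,i_n)$ ($n\ge 1$) is an ordered tuple of distinct input vertices, and $\theta\in V$ is the output vertex, with $a_0$, the inputs and $\theta$ pairwise distinct. A valid 3-coloring is a proper coloring $c:V\to\{0,1,2\}$ (adjacent vertices get distinct colors) with $c(a_0)=0$. A vertex has Boolean value $0$ if its color is $0$ and Boolean value $1$ if its color is in $\{1,2\}$. $\mathcal{L}$ is required to implement a Boolean function $\varphi:\{0,1\}^n\to\{0,1\}$ that depends on every input, meaning: (Universality) every assignment of colors from $\{0,1,2\}$ to the input vertices extends to a valid 3-coloring; (Consistency) in every valid 3-coloring, the Boolean value of $\theta$ equals $\varphi$ applied to the Boolean values of $i_1,\dots,i_n$. -}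

module Defs where

open import Data.Nat using (ℕ; _≥_)
open import Data.Fin using (Fin; zero)
open import Data.Bool using (Bool; true; false; not)
open import Data.Product using (Σ; ∃; _×_; _,_)
open import Data.Sum using (_⊎_)
open import Function using (_∘_)
open import Function.Definitions using (Injective)
open import Relation.Nullary using (¬_)
open import Relation.Binary.PropositionalEquality using (_≡_; _≢_)

record SimpleGraph (m : ℕ) : Set₁ where
  field
    Adj     : Fin m → Fin m → Set
    symm    : ∀ {u v} → Adj u v → Adj v u
    irrefl  : ∀ {v} → ¬ Adj v v
open SimpleGraph public

Colour : Set
Colour = Fin 3

boolVal : Colour → Bool
boolVal zero = false
boolVal _    = true

ValidColouring : ∀ {m} → SimpleGraph m → Fin m → (Fin m → Colour) → Set
ValidColouring G a₀ c = (∀ u v → Adj G u v → c u ≢ c v) × c a₀ ≡ zero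

flipAt : ∀ {n} → Fin n → (Fin n → Bool) → (Fin n → Bool)
flipAt {n} j x k with Data.Fin._≟_ j k
... | Relation.Nullary.yes _ = not (x k)
... | Relation.Nullary.no  _ = x k

DependsOnAll : ∀ {n} → ((Fin n → Bool) → Bool) → Set
DependsOnAll {n} φ = ∀ (j : Fin n) → ∃ λ x → φ x ≢ φ (flipAt j x)

record Implements {m n : ℕ} (G : SimpleGraph m) (a₀ : Fin m)
                  (I : Fin n → Fin m) (θ : Fin m)
                  (φ : (Fin n → Bool) → Bool) : Set where
  field
    universality : ∀ (a : Fin n → Colour) →
      ∃ λ c → ValidColouring G a₀ c × (∀ j → c (I j) ≡ a j)
    consistency  : ∀ (c : Fin m → Colour) → ValidColouring G a₀ c →
      boolVal (c θ) ≡ φ (boolVal ∘ c ∘ I)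

record IsLadget {m n : ℕ} (G : SimpleGraph m) (a₀ : Fin m)
                (I : Fin n → Fin m) (θ : Fin m) : Set where
  field
    n≥1       : n ≥ 1
    I-inj     : Injective _≡_ _≡_ I
    a₀≢θ      : a₀ ≢ θ
    a₀≢I      : ∀ j → a₀ ≢ I j
    θ≢I       : ∀ j → θ ≢ I j
    φ         : (Fin n → Bool) → Bool
    φ-depends : DependsOnAll φ
    implements : Implements G a₀ I θ φ

InIA : ∀ {m n} → Fin m → (Fin n → Fin m) → Fin m → Set
InIA a₀ I x = x ≡ a₀ ⊎ ∃ λ j → x ≡ I j

Internal : ∀ {m n} → Fin m → (Fin n → Fin m) → Fin m → Fin m → Set
Internal a₀ I θ v = v ≢ a₀ × v ≢ θ × (∀ j → v ≢ I j)

-- By universality, any colouring of I ∪ {a₀} that gives a₀ the colour 0 extends to a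
-- valid colouring of the whole ladget. Colouring all of I ∪ {a₀} with 0 shows that it is
-- an independent set. Three distinct members of I ∪ {a₀} contain the anchor at most once,
-- so they can be coloured 0, 1, 2 with the anchor (if present) getting 0; a common
-- neighbour of the three would then have no colour left.
module Submission where

open import Defs
open import Data.Nat using (ℕ)
open import Data.Fin using (Fin; zero; suc; _≟_)
open import Data.Vec.Functional using (updateAt)
open import Data.Vec.Functional.Properties using (updateAt-updates; updateAt-minimal)
open import Data.Product using (_×_; _,_; ∃)
open import Data.Sum using (inj₁; inj₂)
open import Data.Empty using (⊥)
open import Function using (_∘_; const)
open import Relation.Nullary using (¬_; yes; no)
open import Relation.Binary.PropositionalEquality using (_≡_; _≢_; refl; sym; trans)

Proper : ∀ {m} → SimpleGraph m → (Fin m → Colour) → Set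
Proper G c = ∀ u v → Adj G u v → c u ≢ c v

Universal : ∀ {m n} → SimpleGraph m → Fin m → (Fin n → Fin m) → Set
Universal {n = n} G a₀ I =
  ∀ (a : Fin n → Colour) → ∃ λ c → ValidColouring G a₀ c × (∀ j → c (I j) ≡ a j)

proper⇒¬neighbours-of-all-colours : ∀ {m} (G : SimpleGraph m) {c v x y z} → Proper G c →
  Adj G v x → Adj G v y → Adj G v z →
  c x ≡ suc zero → c y ≡ suc (suc zero) → c z ≡ zero → ⊥
proper⇒¬neighbours-of-all-colours G {c} {v} {x} {y} {z} proper vx vy vz cx cy cz
  with c v in cv
... | zero           = proper v z vz (trans cv (sym cz))
... | suc zero       = proper v x vx (trans cv (sym cx))
... | suc (suc zero) = proper v y vy (trans cv (sym cy))

paint : ∀ {m} → Fin m → Fin m → Fin m → Colour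
paint x y = updateAt (updateAt (const zero) x (const (suc zero))) y (const (suc (suc zero)))

module _ {m : ℕ} {x y : Fin m} where

  paint-at₁ : x ≢ y → paint x y x ≡ suc zero
  paint-at₁ x≢y = trans (updateAt-minimal x y _ x≢y) (updateAt-updates x _)

  paint-at₂ : paint x y y ≡ suc (suc zero)
  paint-at₂ = updateAt-updates y _

  paint-elsewhere : ∀ {w} → w ≢ x → w ≢ y → paint x y w ≡ zero
  paint-elsewhere {w} w≢x w≢y = trans (updateAt-minimal w y _ w≢y) (updateAt-minimal w x _ w≢x)

module _ {m n : ℕ} (G : SimpleGraph m) (a₀ : Fin m) (I : Fin n → Fin m)
         (universal : Universal G a₀ I) where

  extend-from-IA : (f : Fin m → Colour) → f a₀ ≡ zero →
    ∃ λ c → ValidColouring G a₀ c × (∀ w → InIA a₀ I w → c w ≡ f w)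
  extend-from-IA f fa₀ with universal (f ∘ I)
  ... | c , valid@(_ , ca₀) , cI = c , valid , agree
    where
    agree : ∀ w → InIA a₀ I w → c w ≡ f w
    agree _ (inj₁ refl)       = trans ca₀ (sym fa₀)
    agree _ (inj₂ (j , refl)) = cI j

  IA-independent : ∀ {x y} → InIA a₀ I x → InIA a₀ I y → ¬ Adj G x y
  IA-independent {x} {y} x∈ y∈ xy with extend-from-IA (const zero) refl
  ... | _ , (proper , _) , agree = proper x y xy (trans (agree x x∈) (sym (agree y y∈)))

  ¬adjacent-to-three-off-anchor : ∀ {v x y z} → InIA a₀ I x → InIA a₀ I y → InIA a₀ I z →
    x ≢ y → y ≢ z → x ≢ z → x ≢ a₀ → y ≢ a₀ → ¬ (Adj G v x × Adj G v y × Adj G v z)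
  ¬adjacent-to-three-off-anchor {v} {x} {y} {z} x∈ y∈ z∈ x≢y y≢z x≢z x≢a₀ y≢a₀ (vx , vy , vz)
    with extend-from-IA (paint x y) (paint-elsewhere (x≢a₀ ∘ sym) (y≢a₀ ∘ sym))
  ... | _ , (proper , _) , agree =
    proper⇒¬neighbours-of-all-colours G proper vx vy vz
      (trans (agree x x∈) (paint-at₁ x≢y))
      (trans (agree y y∈) (paint-at₂ {x = x}))
      (trans (agree z z∈) (paint-elsewhere (x≢z ∘ sym) (y≢z ∘ sym)))

  ¬adjacent-to-three : ∀ {v x y z} → InIA a₀ I x → InIA a₀ I y → InIA a₀ I z →
    x ≢ y → y ≢ z → x ≢ z → ¬ (Adj G v x × Adj G v y × Adj G v z)
  ¬adjacent-to-three {x = x} {y} {z} x∈ y∈ z∈ x≢y y≢z x≢z (vx , vy , vz) with x ≟ a₀ | y ≟ a₀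
  ... | yes refl | _ =
    ¬adjacent-to-three-off-anchor y∈ z∈ x∈ y≢z (x≢z ∘ sym) (x≢y ∘ sym) (x≢y ∘ sym) (x≢z ∘ sym)
      (vy , vz , vx)
  ... | no x≢a₀ | yes refl =
    ¬adjacent-to-three-off-anchor x∈ z∈ y∈ x≢z (y≢z ∘ sym) x≢y x≢a₀ (y≢z ∘ sym)
      (vx , vz , vy)
  ... | no x≢a₀ | no y≢a₀ =
    ¬adjacent-to-three-off-anchor x∈ y∈ z∈ x≢y y≢z x≢z x≢a₀ y≢a₀ (vx , vy , vz)

mainTheorem5 : ∀ {m n : ℕ} (G : SimpleGraph m) (a₀ : Fin m) (I : Fin n → Fin m) (θ : Fin m) →
    IsLadget G a₀ I θ →
    (∀ j k → ¬ Adj G (I j) (I k)) ×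
    (∀ j → ¬ Adj G a₀ (I j)) ×
    (∀ v → Internal a₀ I θ v → ∀ x y z → InIA a₀ I x → InIA a₀ I y → InIA a₀ I z →
      x ≢ y → y ≢ z → x ≢ z → ¬ (Adj G v x × Adj G v y × Adj G v z))
mainTheorem5 G a₀ I θ ladget =
    (λ j k → IA-independent G a₀ I universality (inj₂ (j , refl)) (inj₂ (k , refl)))
  , (λ j → IA-independent G a₀ I universality (inj₁ refl) (inj₂ (j , refl)))
  , (λ v _ x y z → ¬adjacent-to-three G a₀ I universality)
  where
  open Implements (IsLadget.implements ladget)
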